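{- Let $G=(V,E)$ be a graph and $v\in V$. Then $$\mathrm{ID}(G,x)=\mathrm{ID}(G-v,x)-\mathrm{ID}(G\circ v,x)+x\,\mathrm{ID}(G-N[v],x).$$
   Context: All graphs are finite, simple and undirected. $N(v)$ is the open neighborhood of $v$ and $N[v]=N(v)\cup\{v\}$. $G-v$ deletes $v$ and its incident edges. $G-N[v]$ deletes all vertices of $N[v]$; if no vertices remain, $\mathrm{ID}$ of the resulting graph is $1$. A set $W\subseteq V$ is an independent dominating set of $G=(V,E)$ if every vertex of $V\setminus W$ is adjacent to at least one vertex of $W$ and no two vertices of $W$ are adjacent. The independent domination polynomial is $\mathrm{ID}(G,x)=\sum_{W}x^{|W|}$, the sum over all independent dominating sets $W$ of $G$. $G\circ v$ is the graph obtained from $G$ by removing $v$ and adding a loop at each vertex of $N(v)$. For a graph $H$ possibly with loops, $W$ is an independent dominating set if no vertex of $W$ carries a loop, no two vertices of $W$ are adjacent, and every vertex outside $W$ is adjacent to some vertex of $W$ (a loop does not dominate its own vertex). Equivalently, $\mathrm{ID}(G\circ v,x)=\sum x^{|W|}$ over the independent dominating sets $W$ of $G-v$ with $W\cap N(v)=\emptyset$. -}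

module Defs where

open import Data.Nat using (ℕ; zero; suc; _≟_)
open import Data.Integer as ℤ using (ℤ; +_)
open import Data.Bool using (Bool; true; false)
open import Data.Bool.Properties using () renaming (_≟_ to _≟ᵇ_)
open import Data.Fin using (Fin)
open import Data.Fin.Properties using (all?; any?)
open import Data.Fin.Subset using (Subset; _∈_; _∉_; _⊆_; ⊤; ⊥; ∁; _∪_; _-_; ⁅_⁆; ∣_∣)
open import Data.Fin.Subset.Properties using (_∈?_; _⊆?_)
open import Data.List using (List; []; _∷_; map; _++_; length; filter)
open import Data.Vec using (tabulate; _∷_; [])
open import Data.Product using (_×_; ∃)
open import Relation.Nullary using (Dec; ¬?)
open import Relation.Nullary.Decidable using (_×-dec_; _→-dec_)
open import Relation.Binary.PropositionalEquality using (_≡_)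

record Graph (n : ℕ) : Set where
  field
    adj    : Fin n → Fin n → Bool
    sym    : ∀ u w → adj u w ≡ adj w u
    irrefl : ∀ u → adj u u ≡ false
open Graph public

-- Graphs possibly with loops, presented as: an ambient simple graph
-- adjacency on Fin n, a vertex set S ⊆ Fin n (the graph is the induced
-- subgraph on S), and a set L ⊆ S of vertices carrying a loop.

record LGraph (n : ℕ) : Set where
  field
    ladj  : Fin n → Fin n → Bool
    verts : Subset n
    loops : Subset n
open LGraph public

IsIDS : ∀ {n} → LGraph n → Subset n → Set
IsIDS H W =
    (W ⊆ verts H)
  × (∀ i → i ∈ W → i ∉ loops H)
  × (∀ i j → i ∈ W → j ∈ W → ladj H i j ≡ false)
  × (∀ i → i ∈ verts H → i ∉ W → ∃ λ j → j ∈ W × ladj H i j ≡ true)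

isIDS? : ∀ {n} (H : LGraph n) (W : Subset n) → Dec (IsIDS H W)
isIDS? H W =
      (W ⊆? verts H)
  ×-dec all? (λ i → (i ∈? W) →-dec ¬? (i ∈? loops H))
  ×-dec all? (λ i → all? (λ j → (i ∈? W) →-dec ((j ∈? W) →-dec (ladj H i j ≟ᵇ false))))
  ×-dec all? (λ i → (i ∈? verts H) →-dec (¬? (i ∈? W) →-dec
                 any? (λ j → (j ∈? W) ×-dec (ladj H i j ≟ᵇ true))))

allSubsets : (n : ℕ) → List (Subset n)
allSubsets zero    = [] ∷ []
allSubsets (suc n) = map (true ∷_) (allSubsets n) ++ map (false ∷_) (allSubsets n)

-- Polynomials with integer coefficients, as coefficient sequences:
-- p k is the coefficient of x^k.

Poly : Set
Poly = ℕ → ℤ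

_⊕_ : Poly → Poly → Poly
(p ⊕ q) k = p k ℤ.+ q k

_⊖_ : Poly → Poly → Poly
(p ⊖ q) k = p k ℤ.- q k

X*_ : Poly → Poly
(X* p) zero    = + 0
(X* p) (suc k) = p k

infixl 6 _⊕_ _⊖_
infix  7 X*_

ID : ∀ {n} → LGraph n → Poly
ID {n} H k = + length (filter (λ W → isIDS? H W ×-dec (∣ W ∣ ≟ k)) (allSubsets n))

whole : ∀ {n} → Graph n → LGraph n
whole G = record { ladj = adj G ; verts = ⊤ ; loops = ⊥ }

N : ∀ {n} → Graph n → Fin n → Subset n
N G v = tabulate (adj G v)

N[_,_] : ∀ {n} → Graph n → Fin n → Subset n
N[ G , v ] = N G v ∪ ⁅ v ⁆

del : ∀ {n} → Graph n → Fin n → LGraph n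
del G v = record { ladj = adj G ; verts = ⊤ - v ; loops = ⊥ }

delN : ∀ {n} → Graph n → Fin n → LGraph n
delN G v = record { ladj = adj G ; verts = ∁ N[ G , v ] ; loops = ⊥ }

circ : ∀ {n} → Graph n → Fin n → LGraph n
circ G v = record { ladj = adj G ; verts = ⊤ - v ; loops = N G v }

module Submission where

-- Split the independent dominating sets (IDSs) W of G by whether v ∈ W.
--  * v ∉ W.  Such W are exactly the IDSs of G - v containing a neighbour of v
--    (that neighbour is what dominates v).  The IDSs of G - v containing no
--    neighbour of v are exactly the IDSs of G ∘ v (the loops on N(v) forbid
--    exactly those vertices).  Hence, size by size,
--      #{W ∈ IDS(G) : v ∉ W} = #IDS(G - v) - #IDS(G ∘ v).
--  * v ∈ W.  Removing v is a size-decreasing bijection onto IDS(G - N[v]),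
--    which accounts for the factor x.

open import Defs renaming (sym to adj-sym)
open import Data.Nat using (ℕ; zero; suc; _+_; _∸_; _<_) renaming (_≟_ to _≟ℕ_)
open import Data.Nat.Properties using (+-comm; +-suc; suc-injective; m+n∸n≡m; m≤n+m; n≮0)
open import Data.Integer as ℤ using (+_)
open import Data.Integer.Properties using (pos-+; [+m]-[+n]≡m⊖n; ⊖-≥)
open import Data.Bool using (true; false; not)
open import Data.Bool.Properties using (¬-not)
open import Data.Fin using (Fin; zero; suc; _≟_)
open import Data.Fin.Properties using (any?)
open import Data.Fin.Subset using (Subset; _∈_; _∉_; _─_; _-_; ⁅_⁆; ∣_∣)
open import Data.Fin.Subset.Properties
  using (_∈?_; ∈⊤; ∉⊥; x∈⁅x⁆; x∈⁅y⁆⇒x≡y; x∈p∪q⁺; x∈p∪q⁻; x∈∁p⇒x∉p; x∈p∧x≢y⇒x∈p-y; x∉p⇒x∈∁p; x∈p⇒∣p-x∣<∣p∣)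
open import Data.List using (List; []; _∷_; map; _++_; length; filter)
open import Data.List.Properties using (filter-++; length-++; filter-≐; filter-none)
open import Data.List.Relation.Unary.All using (universal)
open import Data.Vec using (_∷_; lookup; _[_]%=_; _[_]=_; here; there)
open import Data.Vec.Properties
  using ([]=⇒lookup; lookup⇒[]=; []=-injective;
         lookup∘tabulate; updateAt-updates; updateAt-minimal; lookup∘updateAt′)
open import Data.Product using (_×_; _,_; proj₁; proj₂; ∃)
open import Data.Sum using (inj₁; inj₂)
open import Data.Empty using (⊥-elim)
open import Function using (_∘_)
open import Level using (0ℓ)
open import Relation.Nullary using (¬_; yes; no; does)
open import Relation.Nullary.Decidable using (_×-dec_)
open import Relation.Unary using (Pred; Decidable; _∩_; _≐_; ∁)
open import Relation.Unary.Properties using (_∩?_; ∁?)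
open import Relation.Binary.PropositionalEquality
  using (_≡_; _≢_; refl; sym; trans; cong; cong₂; subst; module ≡-Reasoning)

count : {A : Set} {P : Pred A 0ℓ} → Decidable P → List A → ℕ
count P? xs = length (filter P? xs)

count-≐ : {A : Set} {P Q : Pred A 0ℓ} (P? : Decidable P) (Q? : Decidable Q) →
          P ≐ Q → ∀ xs → count P? xs ≡ count Q? xs
count-≐ P? Q? P≐Q xs = cong length (filter-≐ P? Q? P≐Q xs)

count-none : {A : Set} {P : Pred A 0ℓ} (P? : Decidable P) →
             (∀ x → ¬ P x) → ∀ xs → count P? xs ≡ 0
count-none P? ¬P xs = cong length (filter-none P? (universal ¬P xs))

count-map : {A B : Set} {P : Pred B 0ℓ} (P? : Decidable P) (f : A → B) →
            ∀ xs → count P? (map f xs) ≡ count (P? ∘ f) xs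
count-map P? f []       = refl
count-map P? f (x ∷ xs) with does (P? (f x))
... | true  = cong suc (count-map P? f xs)
... | false = count-map P? f xs

count-split : {A : Set} {P Q : Pred A 0ℓ} (P? : Decidable P) (Q? : Decidable Q) →
              ∀ xs → count P? xs ≡ count (P? ∩? Q?) xs + count (P? ∩? ∁? Q?) xs
count-split P? Q? []       = refl
count-split P? Q? (x ∷ xs) with P? x | Q? x
... | yes _ | yes _ = cong suc (count-split P? Q? xs)
... | yes _ | no  _ = trans (cong suc (count-split P? Q? xs))
                            (sym (+-suc (count (P? ∩? Q?) xs) _))
... | no  _ | _     = count-split P? Q? xs

count-allSubsets : ∀ {n} {P : Pred (Subset (suc n)) 0ℓ} (P? : Decidable P) →
  count P? (allSubsets (suc n)) ≡
  count (P? ∘ (true ∷_)) (allSubsets n) + count (P? ∘ (false ∷_)) (allSubsets n)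
count-allSubsets {n} P? = begin
  length (filter P? (map (true ∷_) A ++ map (false ∷_) A))
    ≡⟨ cong length (filter-++ P? (map (true ∷_) A) _) ⟩
  length (filter P? (map (true ∷_) A) ++ filter P? (map (false ∷_) A))
    ≡⟨ length-++ (filter P? (map (true ∷_) A)) ⟩
  count P? (map (true ∷_) A) + count P? (map (false ∷_) A)
    ≡⟨ cong₂ _+_ (count-map P? (true ∷_) A) (count-map P? (false ∷_) A) ⟩
  count (P? ∘ (true ∷_)) A + count (P? ∘ (false ∷_)) A ∎
  where
  open ≡-Reasoning
  A : List (Subset n)
  A = allSubsets n

toggle : ∀ {n} → Fin n → Subset n → Subset n
toggle v W = W [ v ]%= not

-- Toggling is a bijection on subsets, so it does not change counts.
count-toggle : ∀ n (v : Fin n) {P : Pred (Subset n) 0ℓ} (P? : Decidable P) →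
  count P? (allSubsets n) ≡ count (P? ∘ toggle v) (allSubsets n)
count-toggle (suc n) zero P? = begin
  count P? (allSubsets (suc n))                   ≡⟨ count-allSubsets P? ⟩
  count (P? ∘ (true ∷_)) A + count (P? ∘ (false ∷_)) A
    ≡⟨ +-comm (count (P? ∘ (true ∷_)) A) _ ⟩
  count (P? ∘ (false ∷_)) A + count (P? ∘ (true ∷_)) A
    ≡⟨ sym (count-allSubsets (P? ∘ toggle zero)) ⟩
  count (P? ∘ toggle zero) (allSubsets (suc n)) ∎
  where
  open ≡-Reasoning
  A : List (Subset n)
  A = allSubsets n
count-toggle (suc n) (suc v) P? =
  trans (count-allSubsets P?)
  (trans (cong₂ _+_ (count-toggle n v (P? ∘ (true ∷_))) (count-toggle n v (P? ∘ (false ∷_))))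
         (sym (count-allSubsets (P? ∘ toggle (suc v)))))

∉⇒[]=false : ∀ {n} {i : Fin n} {W : Subset n} → i ∉ W → W [ i ]= false
∉⇒[]=false {i = i} {W} i∉W with lookup W i in eq
... | true  = ⊥-elim (i∉W (lookup⇒[]= i W eq))
... | false = lookup⇒[]= i W eq

∈-toggle-self : ∀ {n} {v : Fin n} {W} → v ∉ W → v ∈ toggle v W
∈-toggle-self {v = v} {W} v∉W = updateAt-updates v W (∉⇒[]=false v∉W)

∈-toggle-self⁻ : ∀ {n} {v : Fin n} {W} → v ∈ toggle v W → v ∉ W
∈-toggle-self⁻ {v = v} {W} v∈W⁺ v∈W with []=-injective v∈W⁺ (updateAt-updates v {not} W v∈W)
... | ()

∈-toggle-other : ∀ {n} {v i : Fin n} {W} → i ≢ v → i ∈ W → i ∈ toggle v W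
∈-toggle-other {v = v} {i} {W} i≢v = updateAt-minimal i v W i≢v

∈-toggle-other⁻ : ∀ {n} {v i : Fin n} {W} → i ≢ v → i ∈ toggle v W → i ∈ W
∈-toggle-other⁻ {v = v} {i} {W} i≢v i∈W⁺ =
  lookup⇒[]= i W (trans (sym (lookup∘updateAt′ i v i≢v W)) ([]=⇒lookup i∈W⁺))

∣toggle∣ : ∀ {n} {v : Fin n} {W} → v ∉ W → ∣ toggle v W ∣ ≡ suc ∣ W ∣
∣toggle∣ v∉W = insert-size (∉⇒[]=false v∉W)
  where
  insert-size : ∀ {n} {v : Fin n} {W} → W [ v ]= false → ∣ toggle v W ∣ ≡ suc ∣ W ∣
  insert-size here                        = refl
  insert-size {W = true  ∷ _} (there W[v]) = cong suc (insert-size W[v])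
  insert-size {W = false ∷ _} (there W[v]) = insert-size W[v]

∈⇒∣∣≢0 : ∀ {n} {v : Fin n} {W} → v ∈ W → ∣ W ∣ ≢ 0
∈⇒∣∣≢0 {v = v} {W} v∈W ∣W∣≡0 = n≮0 (subst (∣ W - v ∣ <_) ∣W∣≡0 (x∈p⇒∣p-x∣<∣p∣ v∈W))

x∈p─q⇒x∉q : ∀ {n} {p q : Subset n} {i} → i ∈ p ─ q → i ∉ q
x∈p─q⇒x∉q {p = _ ∷ _} {true  ∷ _} {zero}  ()        _
x∈p─q⇒x∉q {p = _ ∷ _} {false ∷ _} {zero}  _         ()
x∈p─q⇒x∉q {p = _ ∷ _} {_     ∷ _} {suc i} (there m) (there m′) = x∈p─q⇒x∉q m m′

module _ {n} (G : Graph n) (v : Fin n) where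

  ∈V[G-v]⇒≢ : ∀ {i} → i ∈ verts (del G v) → i ≢ v
  ∈V[G-v]⇒≢ i∈ refl = x∈p─q⇒x∉q i∈ (x∈⁅x⁆ v)

  ≢⇒∈V[G-v] : ∀ {i} → i ≢ v → i ∈ verts (del G v)
  ≢⇒∈V[G-v] {i} i≢v = x∈p∧x≢y⇒x∈p-y ∈⊤ i≢v

  ∈N⇒adj : ∀ {i} → i ∈ N G v → adj G v i ≡ true
  ∈N⇒adj {i} i∈N = trans (sym (lookup∘tabulate (adj G v) i)) ([]=⇒lookup i∈N)

  adj⇒∈N : ∀ {i} → adj G v i ≡ true → i ∈ N G v
  adj⇒∈N {i} e = lookup⇒[]= i (N G v) (trans (lookup∘tabulate (adj G v) i) e)

  ∉N⇒¬adj : ∀ {i} → i ∉ N G v → adj G v i ≡ false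
  ∉N⇒¬adj i∉N = ¬-not (i∉N ∘ adj⇒∈N)

  ¬adj⇒∉N : ∀ {i} → adj G v i ≡ false → i ∉ N G v
  ¬adj⇒∉N ¬adj i∈N with trans (sym (∈N⇒adj i∈N)) ¬adj
  ... | ()

  ∈V[G-N[v]]⇒ : ∀ {i} → i ∈ verts (delN G v) → adj G v i ≡ false × i ≢ v
  ∈V[G-N[v]]⇒ {i} i∈ =
      ∉N⇒¬adj (i∉N[v] ∘ x∈p∪q⁺ ∘ inj₁)
    , λ { refl → i∉N[v] (x∈p∪q⁺ (inj₂ (x∈⁅x⁆ v))) }
    where
    i∉N[v] : i ∉ N[ G , v ]
    i∉N[v] = x∈∁p⇒x∉p i∈

  ⇒∈V[G-N[v]] : ∀ {i} → adj G v i ≡ false → i ≢ v → i ∈ verts (delN G v)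
  ⇒∈V[G-N[v]] {i} ¬adj i≢v = x∉p⇒x∈∁p i∉N[v]
    where
    i∉N[v] : i ∉ N[ G , v ]
    i∉N[v] i∈ with x∈p∪q⁻ (N G v) ⁅ v ⁆ i∈
    ... | inj₁ i∈N = ¬adj⇒∉N ¬adj i∈N
    ... | inj₂ i∈v = i≢v (x∈⁅y⁆⇒x≡y v i∈v)

  MeetsN : Pred (Subset n) 0ℓ
  MeetsN W = ∃ λ j → j ∈ W × j ∈ N G v

  meetsN? : Decidable MeetsN
  meetsN? W = any? (λ j → (j ∈? W) ×-dec (j ∈? N G v))

  IDS[G∘v] : (IsIDS (del G v) ∩ ∁ MeetsN) ≐ IsIDS (circ G v)
  IDS[G∘v] = to , from
    where
    to : ∀ {W} → IsIDS (del G v) W × ¬ MeetsN W → IsIDS (circ G v) W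
    to ((W⊆ , _ , indep , dom) , ¬meets) =
      W⊆ , (λ i i∈W i∈N → ¬meets (i , i∈W , i∈N)) , indep , dom
    from : ∀ {W} → IsIDS (circ G v) W → IsIDS (del G v) W × ¬ MeetsN W
    from (W⊆ , loopless , indep , dom) =
      (W⊆ , (λ _ _ → ∉⊥) , indep , dom) , λ (j , j∈W , j∈N) → loopless j j∈W j∈N

  -- IDSs of G avoiding v: the IDSs of G - v containing a neighbour of v,
  -- which is then what dominates v.
  IDS[G]-without-v : (IsIDS (del G v) ∩ MeetsN) ≐ (IsIDS (whole G) ∩ ∁ (v ∈_))
  IDS[G]-without-v = to , from
    where
    to : ∀ {W} → IsIDS (del G v) W × MeetsN W → IsIDS (whole G) W × v ∉ W
    to {W} ((W⊆ , _ , indep , dom) , (j , j∈W , j∈N)) =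
      ((λ _ → ∈⊤) , (λ _ _ → ∉⊥) , indep , dom⁺) , λ v∈W → ∈V[G-v]⇒≢ (W⊆ v∈W) refl
      where
      dom⁺ : ∀ i → i ∈ verts (whole G) → i ∉ W → ∃ λ k → k ∈ W × adj G i k ≡ true
      dom⁺ i _ i∉W with i ≟ v
      ... | yes refl = j , j∈W , ∈N⇒adj j∈N
      ... | no  i≢v  = dom i (≢⇒∈V[G-v] i≢v) i∉W
    from : ∀ {W} → IsIDS (whole G) W × v ∉ W → IsIDS (del G v) W × MeetsN W
    from {W} ((_ , _ , indep , dom) , v∉W) =
      (W⊆ , (λ _ _ → ∉⊥) , indep , (λ i _ → dom i ∈⊤)) , meets
      where
      W⊆ : ∀ {i} → i ∈ W → i ∈ verts (del G v)
      W⊆ i∈W = ≢⇒∈V[G-v] λ { refl → v∉W i∈W }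
      meets : MeetsN W
      meets with dom v ∈⊤ v∉W
      ... | j , j∈W , adj-vj = j , j∈W , adj⇒∈N adj-vj

  IDS[G-N[v]]-avoids-v : ∀ {W} → IsIDS (delN G v) W → v ∉ W
  IDS[G-N[v]]-avoids-v (W⊆ , _) v∈W = proj₂ (∈V[G-N[v]]⇒ (W⊆ v∈W)) refl

  -- If v ∉ W and W ∪ {v} is an IDS of G, then W is an IDS of G - N[v]:
  -- W avoids N[v] by independence, and a vertex outside N[v] is dominated
  -- by a member of W ∪ {v} other than v.
  IDS[G]-with-v⇒ : ∀ {W} → v ∉ W → IsIDS (whole G) (toggle v W) → IsIDS (delN G v) W
  IDS[G]-with-v⇒ {W} v∉W (_ , _ , indep , dom) = W⊆ , (λ _ _ → ∉⊥) , indepW , domW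
    where
    ≢v : ∀ {i} → i ∈ W → i ≢ v
    ≢v i∈W refl = v∉W i∈W
    ∈W⁺ : ∀ {i} → i ∈ W → i ∈ toggle v W
    ∈W⁺ i∈W = ∈-toggle-other (≢v i∈W) i∈W
    W⊆ : ∀ {i} → i ∈ W → i ∈ verts (delN G v)
    W⊆ i∈W = ⇒∈V[G-N[v]] (indep v _ (∈-toggle-self v∉W) (∈W⁺ i∈W)) (≢v i∈W)
    indepW : ∀ i j → i ∈ W → j ∈ W → adj G i j ≡ false
    indepW i j i∈W j∈W = indep i j (∈W⁺ i∈W) (∈W⁺ j∈W)
    domW : ∀ i → i ∈ verts (delN G v) → i ∉ W → ∃ λ j → j ∈ W × adj G i j ≡ true
    domW i i∈V i∉W with ∈V[G-N[v]]⇒ i∈V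
    ... | ¬adj-vi , i≢v with dom i ∈⊤ (i∉W ∘ ∈-toggle-other⁻ i≢v)
    ...   | j , j∈W⁺ , adj-ij = j , ∈-toggle-other⁻ j≢v j∈W⁺ , adj-ij
      where
      j≢v : j ≢ v
      j≢v refl with trans (sym (trans (adj-sym G v i) adj-ij)) ¬adj-vi
      ... | ()

  -- Conversely, adding v to an IDS W of G - N[v] gives an IDS of G: members
  -- of W are not adjacent to v, and v dominates all of N(v).
  IDS[G]-with-v⇐ : ∀ {W} → IsIDS (delN G v) W → IsIDS (whole G) (toggle v W)
  IDS[G]-with-v⇐ {W} ids@(W⊆ , _ , indep , dom) = (λ _ → ∈⊤) , (λ _ _ → ∉⊥) , indep⁺ , dom⁺
    where
    v∉W : v ∉ W
    v∉W = IDS[G-N[v]]-avoids-v ids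
    v∈W⁺ : v ∈ toggle v W
    v∈W⁺ = ∈-toggle-self v∉W
    apart : ∀ {i} → i ∈ W → adj G v i ≡ false
    apart i∈W = proj₁ (∈V[G-N[v]]⇒ (W⊆ i∈W))
    indep⁺ : ∀ i j → i ∈ toggle v W → j ∈ toggle v W → adj G i j ≡ false
    indep⁺ i j i∈ j∈ with i ≟ v | j ≟ v
    ... | yes refl | yes refl = irrefl G v
    ... | yes refl | no  j≢v  = apart (∈-toggle-other⁻ j≢v j∈)
    ... | no  i≢v  | yes refl = trans (adj-sym G i v) (apart (∈-toggle-other⁻ i≢v i∈))
    ... | no  i≢v  | no  j≢v  = indep i j (∈-toggle-other⁻ i≢v i∈) (∈-toggle-other⁻ j≢v j∈)
    dom⁺ : ∀ i → i ∈ verts (whole G) → i ∉ toggle v W →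
           ∃ λ j → j ∈ toggle v W × adj G i j ≡ true
    dom⁺ i _ i∉W⁺ with i ≟ v
    ... | yes refl = ⊥-elim (i∉W⁺ v∈W⁺)
    ... | no  i≢v with adj G v i in adj-vi
    ...   | true  = v , v∈W⁺ , trans (adj-sym G i v) adj-vi
    ...   | false with dom i (⇒∈V[G-N[v]] adj-vi i≢v) (i∉W⁺ ∘ ∈-toggle-other i≢v)
    ...     | j , j∈W , adj-ij = j , ∈-toggle-other (λ { refl → v∉W j∈W }) j∈W , adj-ij

Sized : ∀ {n} → Pred (Subset n) 0ℓ → ℕ → Pred (Subset n) 0ℓ
Sized P k = P ∩ (λ W → ∣ W ∣ ≡ k)

idsOfSize? : ∀ {n} (H : LGraph n) (k : ℕ) → Decidable (Sized (IsIDS H) k)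
idsOfSize? H k = isIDS? H ∩? (λ W → ∣ W ∣ ≟ℕ k)

Sized-≐ : ∀ {n} {P Q R S : Pred (Subset n) 0ℓ} {k} →
          (P ∩ Q) ≐ (R ∩ S) → (Sized P k ∩ Q) ≐ (Sized R k ∩ S)
Sized-≐ (to , from) =
    (λ ((p , size) , q) → let r , s = to (p , q)   in (r , size) , s)
  , (λ ((r , size) , s) → let p , q = from (r , s) in (p , size) , q)

Sized-≐′ : ∀ {n} {P Q R : Pred (Subset n) 0ℓ} {k} →
           (P ∩ Q) ≐ R → (Sized P k ∩ Q) ≐ Sized R k
Sized-≐′ (to , from) =
    (λ ((p , size) , q) → to (p , q) , size)
  , (λ (r , size) → let p , q = from r in (p , size) , q)

+-minus : ∀ a c → + a ≡ + (a + c) ℤ.- + c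
+-minus a c = begin
  + a               ≡⟨ cong +_ (sym (m+n∸n≡m a c)) ⟩
  + (a + c ∸ c)     ≡⟨ sym (⊖-≥ (m≤n+m c a)) ⟩
  (a + c) ℤ.⊖ c     ≡⟨ sym ([+m]-[+n]≡m⊖n (a + c) c) ⟩
  + (a + c) ℤ.- + c ∎
  where open ≡-Reasoning

module Counting {n} (G : Graph n) (v : Fin n) where

  # : {P : Pred (Subset n) 0ℓ} → Decidable P → ℕ
  # P? = count P? (allSubsets n)

  count-without-v : ∀ k →
    + # (idsOfSize? (whole G) k ∩? ∁? (v ∈?_)) ≡ ID (del G v) k ℤ.- ID (circ G v) k
  count-without-v k = begin
    + # without
      ≡⟨ +-minus (# without) (# (idsOfSize? (circ G v) k)) ⟩
    + (# without + # (idsOfSize? (circ G v) k)) ℤ.- ID (circ G v) k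
      ≡⟨ cong (λ m → + m ℤ.- ID (circ G v) k) (sym del-split) ⟩
    ID (del G v) k ℤ.- ID (circ G v) k ∎
    where
    open ≡-Reasoning
    without : Decidable (Sized (IsIDS (whole G)) k ∩ ∁ (v ∈_))
    without = idsOfSize? (whole G) k ∩? ∁? (v ∈?_)
    del-split : # (idsOfSize? (del G v) k) ≡ # without + # (idsOfSize? (circ G v) k)
    del-split = trans (count-split (idsOfSize? (del G v) k) (meetsN? G v) (allSubsets n))
      (cong₂ _+_ (count-≐ _ _ (Sized-≐ (IDS[G]-without-v G v)) (allSubsets n))
                 (count-≐ _ _ (Sized-≐′ (IDS[G∘v] G v)) (allSubsets n)))

  count-with-v : ∀ k → + # (idsOfSize? (whole G) k ∩? (v ∈?_)) ≡ (X* ID (delN G v)) k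
  count-with-v zero    =
    cong +_ (count-none _ (λ _ ((_ , ∣W∣≡0) , v∈W) → ∈⇒∣∣≢0 v∈W ∣W∣≡0) (allSubsets n))
  count-with-v (suc k) = cong +_ (trans (count-toggle n v _)
                                       (count-≐ _ _ remove-v (allSubsets n)))
    where
    remove-v : (Sized (IsIDS (whole G)) (suc k) ∩ (v ∈_)) ∘ toggle v ≐ Sized (IsIDS (delN G v)) k
    remove-v = to , from
      where
      to : ∀ {W} → (IsIDS (whole G) (toggle v W) × ∣ toggle v W ∣ ≡ suc k) × v ∈ toggle v W →
           IsIDS (delN G v) W × ∣ W ∣ ≡ k
      to {W} ((ids , size) , v∈W⁺) =
        IDS[G]-with-v⇒ G v v∉W ids , suc-injective (trans (sym (∣toggle∣ v∉W)) size)
        where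
        v∉W : v ∉ W
        v∉W = ∈-toggle-self⁻ v∈W⁺
      from : ∀ {W} → IsIDS (delN G v) W × ∣ W ∣ ≡ k →
             (IsIDS (whole G) (toggle v W) × ∣ toggle v W ∣ ≡ suc k) × v ∈ toggle v W
      from {W} (ids , size) =
        (IDS[G]-with-v⇐ G v ids , trans (∣toggle∣ v∉W) (cong suc size)) , ∈-toggle-self v∉W
        where
        v∉W : v ∉ W
        v∉W = IDS[G-N[v]]-avoids-v G v ids

open Counting

mainTheorem12 : ∀ {n} (G : Graph n) (v : Fin n) (k : ℕ) →
    ID (whole G) k ≡ (ID (del G v) ⊖ ID (circ G v) ⊕ X* ID (delN G v)) k
mainTheorem12 {n} G v k = begin
  ID (whole G) k
    ≡⟨ cong +_ (count-split (idsOfSize? (whole G) k) (v ∈?_) (allSubsets n)) ⟩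
  + (# G v with-v + # G v without-v)
    ≡⟨ cong +_ (+-comm (# G v with-v) _) ⟩
  + (# G v without-v + # G v with-v)
    ≡⟨ pos-+ (# G v without-v) _ ⟩
  + # G v without-v ℤ.+ + # G v with-v
    ≡⟨ cong₂ ℤ._+_ (count-without-v G v k) (count-with-v G v k) ⟩
  (ID (del G v) ⊖ ID (circ G v) ⊕ X* ID (delN G v)) k ∎
  where
  open ≡-Reasoning
  with-v : Decidable (Sized (IsIDS (whole G)) k ∩ (v ∈_))
  with-v = idsOfSize? (whole G) k ∩? (v ∈?_)
  without-v : Decidable (Sized (IsIDS (whole G)) k ∩ ∁ (v ∈_))
  without-v = idsOfSize? (whole G) k ∩? ∁? (v ∈?_)
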